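{- Let L be either of the calculi QGP or QGPM. If $\Gamma$ is a set of Harrop formulas and L $\vdash\Gamma\Rightarrow\alpha\vee\beta$, then L $\vdash\Gamma\Rightarrow\alpha$ or L $\vdash\Gamma\Rightarrow\beta$.
   Context: Language: first-order, predicate symbols and constants, no function symbols; connectives $\top,\wedge,\vee,\rightarrow,\forall,\exists$; disjoint sets of free variables $a,b,\dots$ (only free) and bound variables $x,y,\dots$ (only bound). $\phi[u/x]$ is substitution; $\phi(a)$ is $\phi(x)$ with $a$ for $x$. QGPM: sequents $\Gamma\Rightarrow\Delta$ ($\Gamma,\Delta$ finite sets); axioms $\phi\Rightarrow\phi$, $\Rightarrow\top$; rules ($\wedge$L) $\Gamma,\phi,\psi\Rightarrow\Delta$ / $\Gamma,\phi\wedge\psi\Rightarrow\Delta$; ($\wedge$R) $\Gamma\Rightarrow\Delta,\phi$ and $\Gamma\Rightarrow\Delta,\psi$ / $\Gamma\Rightarrow\Delta,\phi\wedge\psi$; ($\vee$L) $\Gamma,\phi\Rightarrow\Delta$ and $\Gamma,\psi\Rightarrow\Delta$ / $\Gamma,\phi\vee\psi\Rightarrow\Delta$; ($\vee$R) $\Gamma\Rightarrow\Delta,\phi,\psi$ / $\Gamma\Rightarrow\Delta,\phi\vee\psi$; ($\rightarrow$L) $\Gamma,\psi\Rightarrow\Delta$ and $\Gamma\Rightarrow\Delta,\phi$ / $\Gamma,\phi\rightarrow\psi\Rightarrow\Delta$; ($\rightarrow$Rp) $\Gamma\Rightarrow\psi,\Delta$ / $\Gamma\Rightarrow\phi\rightarrow\psi,\Delta$;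 ($\forall$R) $\Gamma\Rightarrow\Delta,\phi(a)$ / $\Gamma\Rightarrow\Delta,\forall x\phi(x)$ with $a$ not occurring in the conclusion; ($\forall$L) $\Gamma,\phi[u/x]\Rightarrow\Delta$ / $\Gamma,\forall x\phi(x)\Rightarrow\Delta$, $u$ a constant or free variable; ($\exists$R) $\Gamma\Rightarrow\Delta,\phi[u/x]$ / $\Gamma\Rightarrow\Delta,\exists x\phi(x)$; ($\exists$L) $\Gamma,\phi(a)\Rightarrow\Delta$ / $\Gamma,\exists x\phi(x)\Rightarrow\Delta$ with $a$ not in the conclusion; (Weakening) $\Gamma\Rightarrow\Delta$ / $\Gamma,\Gamma_1\Rightarrow\Delta,\Delta_1$; (Cut) $\Gamma\Rightarrow\Delta,\phi$ and $\phi,\Gamma_1\Rightarrow\Delta_1$ / $\Gamma,\Gamma_1\Rightarrow\Delta,\Delta_1$. QGP: single-conclusion version with sequents $\Gamma\Rightarrow\theta$ (exactly one formula on the right); axioms $\phi\Rightarrow\phi$, $\Rightarrow\top$; rules ($\wedge$L) $\Gamma,\phi,\psi\Rightarrow\theta$ / $\Gamma,\phi\wedge\psi\Rightarrow\theta$; ($\wedge$R) $\Gamma\Rightarrow\phi$, $\Gamma\Rightarrow\psi$ / $\Gamma\Rightarrow\phi\wedge\psi$; ($\vee$L) $\Gamma,\phi\Rightarrow\theta$ and $\Gamma,\psi\Rightarrow\theta$ / $\Gamma,\phi\vee\psi\Rightarrow\theta$; ($\vee$R) $\Gamma\Rightarrow\phi_i$ / $\Gamma\Rightarrow\phi_1\vee\phi_2$;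 ($\rightarrow$L) $\Gamma,\psi\Rightarrow\theta$ and $\Gamma\Rightarrow\phi$ / $\Gamma,\phi\rightarrow\psi\Rightarrow\theta$; ($\rightarrow$Rp) $\Gamma\Rightarrow\psi$ / $\Gamma\Rightarrow\phi\rightarrow\psi$; ($\forall$R) $\Gamma\Rightarrow\phi(a)$ / $\Gamma\Rightarrow\forall x\phi(x)$ ($a$ not in conclusion); ($\forall$L) $\Gamma,\phi[u/x]\Rightarrow\theta$ / $\Gamma,\forall x\phi(x)\Rightarrow\theta$; ($\exists$R) $\Gamma\Rightarrow\phi[u/x]$ / $\Gamma\Rightarrow\exists x\phi(x)$; ($\exists$L) $\Gamma,\phi(a)\Rightarrow\theta$ / $\Gamma,\exists x\phi(x)\Rightarrow\theta$ ($a$ not in conclusion); (Weakening) $\Gamma\Rightarrow\theta$ / $\Gamma,\Gamma_1\Rightarrow\theta$; (Cut) $\Gamma\Rightarrow\phi$ and $\phi,\Gamma_1\Rightarrow\theta$ / $\Gamma,\Gamma_1\Rightarrow\theta$. Harrop formulas $H$ are given by the grammar $H ::= \top \mid A \mid H\wedge H \mid B\rightarrow H \mid \forall x H(x)$, where $A$ is any atomic formula and $B$ is any formula. -}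

module Defs where

open import Data.Nat using (ℕ; _≡ᵇ_)
open import Data.Bool using (Bool; true; false; if_then_else_; _∨_)
open import Data.List using (List; []; _∷_; _++_; [_])
open import Data.List.Membership.Propositional using (_∈_)
open import Data.List.Relation.Unary.All using (All)
open import Data.Product using (_×_)
open import Relation.Binary.PropositionalEquality using (_≡_)

-- Syntax.  Free variables, constants and bound variables are named by
-- natural numbers; free variables and bound variables are disjoint
-- syntactic categories.  No function symbols.

data Term : Set where
  fv : ℕ → Term
  cn : ℕ → Term

data Arg : Set where
  bv : ℕ → Arg
  tm : Term → Arg

infixr 6 _∧ᶠ_
infixr 5 _∨ᶠ_
infixr 4 _⇒ᶠ_

data Formula : Set where
  atom : ℕ → List Arg → Formula
  ⊤ᶠ   : Formula
  _∧ᶠ_ : Formula → Formula → Formula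
  _∨ᶠ_ : Formula → Formula → Formula
  _⇒ᶠ_ : Formula → Formula → Formula
  Fall : ℕ → Formula → Formula
  Fex  : ℕ → Formula → Formula

substArg : ℕ → Term → Arg → Arg
substArg x u (bv y) = if x ≡ᵇ y then tm u else bv y
substArg x u (tm t) = tm t

substArgs : ℕ → Term → List Arg → List Arg
substArgs x u []       = []
substArgs x u (a ∷ as) = substArg x u a ∷ substArgs x u as

_[_/_] : Formula → Term → ℕ → Formula
atom P as [ u / x ] = atom P (substArgs x u as)
⊤ᶠ        [ u / x ] = ⊤ᶠ
(φ ∧ᶠ ψ)  [ u / x ] = (φ [ u / x ]) ∧ᶠ (ψ [ u / x ])
(φ ∨ᶠ ψ)  [ u / x ] = (φ [ u / x ]) ∨ᶠ (ψ [ u / x ])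
(φ ⇒ᶠ ψ)  [ u / x ] = (φ [ u / x ]) ⇒ᶠ (ψ [ u / x ])
Fall y φ  [ u / x ] = if x ≡ᵇ y then Fall y φ else Fall y (φ [ u / x ])
Fex  y φ  [ u / x ] = if x ≡ᵇ y then Fex y φ else Fex y (φ [ u / x ])

-- Well-formedness: bound variables occur only bound.

ClosedArg : List ℕ → Arg → Set
ClosedArg sc (bv y) = y ∈ sc
ClosedArg sc (tm t) = Data.Unit.⊤ where import Data.Unit

ClosedIn : List ℕ → Formula → Set
ClosedIn sc (atom P as) = All (ClosedArg sc) as
ClosedIn sc ⊤ᶠ          = Data.Unit.⊤ where import Data.Unit
ClosedIn sc (φ ∧ᶠ ψ)    = ClosedIn sc φ × ClosedIn sc ψ
ClosedIn sc (φ ∨ᶠ ψ)    = ClosedIn sc φ × ClosedIn sc ψ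
ClosedIn sc (φ ⇒ᶠ ψ)    = ClosedIn sc φ × ClosedIn sc ψ
ClosedIn sc (Fall x φ)  = ClosedIn (x ∷ sc) φ
ClosedIn sc (Fex x φ)   = ClosedIn (x ∷ sc) φ

Closed : Formula → Set
Closed = ClosedIn []

occArg : ℕ → Arg → Bool
occArg a (bv y)      = false
occArg a (tm (fv b)) = a ≡ᵇ b
occArg a (tm (cn c)) = false

occArgs : ℕ → List Arg → Bool
occArgs a []       = false
occArgs a (t ∷ ts) = occArg a t ∨ occArgs a ts

occ : ℕ → Formula → Bool
occ a (atom P as) = occArgs a as
occ a ⊤ᶠ          = false
occ a (φ ∧ᶠ ψ)    = occ a φ ∨ occ a ψ
occ a (φ ∨ᶠ ψ)    = occ a φ ∨ occ a ψ
occ a (φ ⇒ᶠ ψ)    = occ a φ ∨ occ a ψ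
occ a (Fall x φ)  = occ a φ
occ a (Fex x φ)   = occ a φ

FreshL : ℕ → List Formula → Set
FreshL a Γ = All (λ φ → occ a φ ≡ false) Γ

-- Finite sets of formulas are represented by lists, identified up to
-- having the same elements.

_≈ˢ_ : List Formula → List Formula → Set
Γ ≈ˢ Γ' = ∀ φ → (φ ∈ Γ → φ ∈ Γ') × (φ ∈ Γ' → φ ∈ Γ)

-- QGPM (multi-conclusion).  "Γ , φ" is φ ∷ Γ, "Γ , Γ₁" is Γ ++ Γ₁.
-- Side conditions 'Closed' only ensure that formulas introduced from
-- nothing are well-formed formulas of the language.

infix 2 _⊢ᴹ_ _⊢ᴵ_

data _⊢ᴹ_ : List Formula → List Formula → Set where
  ax    : ∀ {φ} → Closed φ → [ φ ] ⊢ᴹ [ φ ]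
  ax⊤   : [] ⊢ᴹ [ ⊤ᶠ ]
  ∧L    : ∀ {Γ Δ φ ψ} → φ ∷ ψ ∷ Γ ⊢ᴹ Δ → (φ ∧ᶠ ψ) ∷ Γ ⊢ᴹ Δ
  ∧R    : ∀ {Γ Δ φ ψ} → Γ ⊢ᴹ φ ∷ Δ → Γ ⊢ᴹ ψ ∷ Δ → Γ ⊢ᴹ (φ ∧ᶠ ψ) ∷ Δ
  ∨L    : ∀ {Γ Δ φ ψ} → φ ∷ Γ ⊢ᴹ Δ → ψ ∷ Γ ⊢ᴹ Δ → (φ ∨ᶠ ψ) ∷ Γ ⊢ᴹ Δ
  ∨R    : ∀ {Γ Δ φ ψ} → Γ ⊢ᴹ φ ∷ ψ ∷ Δ → Γ ⊢ᴹ (φ ∨ᶠ ψ) ∷ Δ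
  ⇒L    : ∀ {Γ Δ φ ψ} → ψ ∷ Γ ⊢ᴹ Δ → Γ ⊢ᴹ φ ∷ Δ → (φ ⇒ᶠ ψ) ∷ Γ ⊢ᴹ Δ
  ⇒Rp   : ∀ {Γ Δ φ ψ} → Closed φ → Γ ⊢ᴹ ψ ∷ Δ → Γ ⊢ᴹ (φ ⇒ᶠ ψ) ∷ Δ
  ∀R    : ∀ {Γ Δ x φ} a → FreshL a Γ → FreshL a (Fall x φ ∷ Δ) →
          Γ ⊢ᴹ (φ [ fv a / x ]) ∷ Δ → Γ ⊢ᴹ Fall x φ ∷ Δ
  ∀L    : ∀ {Γ Δ x φ} (u : Term) → (φ [ u / x ]) ∷ Γ ⊢ᴹ Δ → Fall x φ ∷ Γ ⊢ᴹ Δ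
  ∃R    : ∀ {Γ Δ x φ} (u : Term) → Γ ⊢ᴹ (φ [ u / x ]) ∷ Δ → Γ ⊢ᴹ Fex x φ ∷ Δ
  ∃L    : ∀ {Γ Δ x φ} a → FreshL a (Fex x φ ∷ Γ) → FreshL a Δ →
          (φ [ fv a / x ]) ∷ Γ ⊢ᴹ Δ → Fex x φ ∷ Γ ⊢ᴹ Δ
  weak  : ∀ {Γ Δ Γ₁ Δ₁} → All Closed Γ₁ → All Closed Δ₁ →
          Γ ⊢ᴹ Δ → Γ ++ Γ₁ ⊢ᴹ Δ ++ Δ₁
  cut   : ∀ {Γ Δ Γ₁ Δ₁ φ} → Closed φ → Γ ⊢ᴹ φ ∷ Δ → φ ∷ Γ₁ ⊢ᴹ Δ₁ →
          Γ ++ Γ₁ ⊢ᴹ Δ ++ Δ₁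
  -- sequents are built from finite sets
  sets  : ∀ {Γ Γ' Δ Δ'} → Γ ≈ˢ Γ' → Δ ≈ˢ Δ' → Γ ⊢ᴹ Δ → Γ' ⊢ᴹ Δ'

data _⊢ᴵ_ : List Formula → Formula → Set where
  ax    : ∀ {φ} → Closed φ → [ φ ] ⊢ᴵ φ
  ax⊤   : [] ⊢ᴵ ⊤ᶠ
  ∧L    : ∀ {Γ θ φ ψ} → φ ∷ ψ ∷ Γ ⊢ᴵ θ → (φ ∧ᶠ ψ) ∷ Γ ⊢ᴵ θ
  ∧R    : ∀ {Γ φ ψ} → Γ ⊢ᴵ φ → Γ ⊢ᴵ ψ → Γ ⊢ᴵ φ ∧ᶠ ψ
  ∨L    : ∀ {Γ θ φ ψ} → φ ∷ Γ ⊢ᴵ θ → ψ ∷ Γ ⊢ᴵ θ → (φ ∨ᶠ ψ) ∷ Γ ⊢ᴵ θ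
  ∨R₁   : ∀ {Γ φ ψ} → Closed ψ → Γ ⊢ᴵ φ → Γ ⊢ᴵ φ ∨ᶠ ψ
  ∨R₂   : ∀ {Γ φ ψ} → Closed φ → Γ ⊢ᴵ ψ → Γ ⊢ᴵ φ ∨ᶠ ψ
  ⇒L    : ∀ {Γ θ φ ψ} → ψ ∷ Γ ⊢ᴵ θ → Γ ⊢ᴵ φ → (φ ⇒ᶠ ψ) ∷ Γ ⊢ᴵ θ
  ⇒Rp   : ∀ {Γ φ ψ} → Closed φ → Γ ⊢ᴵ ψ → Γ ⊢ᴵ φ ⇒ᶠ ψ
  ∀R    : ∀ {Γ x φ} a → FreshL a (Fall x φ ∷ Γ) →
          Γ ⊢ᴵ (φ [ fv a / x ]) → Γ ⊢ᴵ Fall x φ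
  ∀L    : ∀ {Γ θ x φ} (u : Term) → (φ [ u / x ]) ∷ Γ ⊢ᴵ θ → Fall x φ ∷ Γ ⊢ᴵ θ
  ∃R    : ∀ {Γ x φ} (u : Term) → Γ ⊢ᴵ (φ [ u / x ]) → Γ ⊢ᴵ Fex x φ
  ∃L    : ∀ {Γ θ x φ} a → FreshL a (θ ∷ Fex x φ ∷ Γ) →
          (φ [ fv a / x ]) ∷ Γ ⊢ᴵ θ → Fex x φ ∷ Γ ⊢ᴵ θ
  weak  : ∀ {Γ Γ₁ θ} → All Closed Γ₁ → Γ ⊢ᴵ θ → Γ ++ Γ₁ ⊢ᴵ θ
  cut   : ∀ {Γ Γ₁ φ θ} → Closed φ → Γ ⊢ᴵ φ → φ ∷ Γ₁ ⊢ᴵ θ → Γ ++ Γ₁ ⊢ᴵ θ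
  sets  : ∀ {Γ Γ' θ} → Γ ≈ˢ Γ' → Γ ⊢ᴵ θ → Γ' ⊢ᴵ θ

data Harrop : Formula → Set where
  h⊤    : Harrop ⊤ᶠ
  hatom : ∀ P as → Harrop (atom P as)
  h∧    : ∀ {φ ψ} → Harrop φ → Harrop ψ → Harrop (φ ∧ᶠ ψ)
  h⇒    : ∀ {φ ψ} → Harrop ψ → Harrop (φ ⇒ᶠ ψ)
  h∀    : ∀ {x φ} → Harrop φ → Harrop (Fall x φ)

-- Aczel's slash relative to Γ₀. A formula is slashed when it is provable from Γ₀ and,
-- hereditarily, a disjunction has a provable slashed disjunct, an existential a provable
-- slashed instance, a universal only slashed instances, and an implication a slashed
-- conclusion (under every substitution for variables not free in Γ₀) whenever its premise
-- is provable. Provable Harrop formulas are slashed, since their strictly positive parts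
-- contain no ∨ or ∃. Every rule of QGPM preserves the slash in the multi-conclusion sense
-- (if every antecedent formula is slashed, some succedent formula is), so from Harrop Γ₀
-- and Γ₀ ⇒ α ∨ β the formula α ∨ β is slashed, that is, α or β is provable from Γ₀. The
-- argument only uses closure properties of provability shared by QGP and QGPM, and QGP
-- embeds into QGPM, so it gives the disjunction property for both calculi.

module Submission where

open import Defs
open import Data.Bool using (true; false; T; if_then_else_; _∨_)
open import Data.Bool.Properties using (∨-conicalˡ; ∨-conicalʳ)
open import Data.List using (List; []; _∷_; _++_; [_]; map)
open import Data.List.Properties using (++-identityʳ; map-cong; map-id)
open import Data.List.Membership.Propositional using (_∈_)
open import Data.List.Membership.Propositional.Properties using (∈-++⁻)
open import Data.List.Relation.Binary.Subset.Propositional using (_⊆_)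
open import Data.List.Relation.Binary.Subset.Propositional.Properties
  using (⊆-refl; ⊆-reflexive-↭; xs⊆x∷xs; xs⊆xs++ys; ∷⁺ʳ; ∈-∷⁺ʳ; All-resp-⊇; Any-resp-⊆)
import Data.List.Relation.Binary.Permutation.Propositional as ↭
open import Data.List.Relation.Unary.All as All using (All; []; _∷_)
open import Data.List.Relation.Unary.All.Properties using (map⁺; ++⁺; ++⁻ˡ; ++⁻ʳ)
open import Data.List.Relation.Unary.Any using (Any; here; there)
import Data.List.Relation.Unary.Any.Properties as Anyₚ
open import Data.Nat using (ℕ; zero; suc; _≡ᵇ_; _⊔_; _<_; s≤s; s≤s⁻¹)
open import Data.Nat.Properties
  using (≡ᵇ⇒≡; ≡⇒≡ᵇ; <⇒≢; >⇒≢; ≤-refl; ≤-reflexive; m≤m⊔n; m≤n⊔m; m⊔n<o⇒m<o; m⊔n<o⇒n<o)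
open import Data.Product using (_×_; _,_; proj₁; proj₂; ∃-syntax)
open import Data.Sum as Sum using (_⊎_; inj₁; inj₂; reduce)
open import Function using (_∘_)
open import Data.Unit using (⊤; tt)
open import Relation.Nullary using (contradiction)
open import Relation.Binary.PropositionalEquality
  using (_≡_; _≢_; refl; sym; trans; cong; cong₂; subst; module ≡-Reasoning)

Subst : Set
Subst = ℕ → Term

private variable
  a b c n x y : ℕ
  t : Term
  φ ψ θ α β : Formula
  σ : Subst
  sc sc' : List ℕ
  Γ Γ' Δ : List Formula

≡ᵇ-refl : ∀ n → (n ≡ᵇ n) ≡ true
≡ᵇ-refl zero    = refl
≡ᵇ-refl (suc n) = ≡ᵇ-refl n

≡ᵇ-true⇒≡ : (a ≡ᵇ b) ≡ true → a ≡ b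
≡ᵇ-true⇒≡ {a} {b} eq = ≡ᵇ⇒≡ a b (subst T (sym eq) tt)

≡ᵇ-false⇒≢ : (a ≡ᵇ b) ≡ false → a ≢ b
≡ᵇ-false⇒≢ {a} {b} eq a≡b = subst T eq (≡⇒≡ᵇ a b a≡b)

≢⇒≡ᵇ-false : a ≢ b → (a ≡ᵇ b) ≡ false
≢⇒≡ᵇ-false {a} {b} a≢b with a ≡ᵇ b in eq
... | true  = contradiction (≡ᵇ-true⇒≡ eq) a≢b
... | false = refl

-- Substitution of free variables

subTerm : Subst → Term → Term
subTerm σ (fv a) = σ a
subTerm σ (cn k) = cn k

subArg : Subst → Arg → Arg
subArg σ (bv y) = bv y
subArg σ (tm t) = tm (subTerm σ t)

sub : Subst → Formula → Formula
sub σ (atom P as) = atom P (map (subArg σ) as)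
sub σ ⊤ᶠ          = ⊤ᶠ
sub σ (φ ∧ᶠ ψ)    = sub σ φ ∧ᶠ sub σ ψ
sub σ (φ ∨ᶠ ψ)    = sub σ φ ∨ᶠ sub σ ψ
sub σ (φ ⇒ᶠ ψ)    = sub σ φ ⇒ᶠ sub σ ψ
sub σ (Fall x φ)  = Fall x (sub σ φ)
sub σ (Fex x φ)   = Fex x (sub σ φ)

_[_↦_] : Subst → ℕ → Term → Subst
(σ [ a ↦ t ]) b = if a ≡ᵇ b then t else σ b

_≔_ : ℕ → Term → Subst
a ≔ t = fv [ a ↦ t ]

sub-inst : ∀ σ x t φ → sub σ (φ [ t / x ]) ≡ sub σ φ [ subTerm σ t / x ]
sub-inst σ x t (atom P as) = cong (atom P) (args as)
  where
  args : ∀ as → map (subArg σ) (substArgs x t as) ≡ substArgs x (subTerm σ t) (map (subArg σ) as)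
  args []          = refl
  args (tm s ∷ as) = cong (tm (subTerm σ s) ∷_) (args as)
  args (bv y ∷ as) with x ≡ᵇ y
  ... | true  = cong (tm (subTerm σ t) ∷_) (args as)
  ... | false = cong (bv y ∷_) (args as)
sub-inst σ x t ⊤ᶠ         = refl
sub-inst σ x t (φ ∧ᶠ ψ)   = cong₂ _∧ᶠ_ (sub-inst σ x t φ) (sub-inst σ x t ψ)
sub-inst σ x t (φ ∨ᶠ ψ)   = cong₂ _∨ᶠ_ (sub-inst σ x t φ) (sub-inst σ x t ψ)
sub-inst σ x t (φ ⇒ᶠ ψ)   = cong₂ _⇒ᶠ_ (sub-inst σ x t φ) (sub-inst σ x t ψ)
sub-inst σ x t (Fall y φ) with x ≡ᵇ y
... | true  = refl
... | false = cong (Fall y) (sub-inst σ x t φ)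
sub-inst σ x t (Fex y φ) with x ≡ᵇ y
... | true  = refl
... | false = cong (Fex y) (sub-inst σ x t φ)

sub-update-fresh : ∀ σ a t φ → occ a φ ≡ false → sub (σ [ a ↦ t ]) φ ≡ sub σ φ
sub-update-fresh σ a t (atom P as) a∉ = cong (atom P) (args as a∉)
  where
  args : ∀ as → occArgs a as ≡ false → map (subArg (σ [ a ↦ t ])) as ≡ map (subArg σ) as
  args []               _   = refl
  args (bv y ∷ as)      a∉  = cong (bv y ∷_) (args as a∉)
  args (tm (cn k) ∷ as) a∉  = cong (tm (cn k) ∷_) (args as a∉)
  args (tm (fv b) ∷ as) a∉
    rewrite ∨-conicalˡ (a ≡ᵇ b) _ a∉ = cong (tm (σ b) ∷_) (args as (∨-conicalʳ (a ≡ᵇ b) _ a∉))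
sub-update-fresh σ a t ⊤ᶠ a∉ = refl
sub-update-fresh σ a t (φ ∧ᶠ ψ) a∉ =
  cong₂ _∧ᶠ_ (sub-update-fresh σ a t φ (∨-conicalˡ _ _ a∉))
             (sub-update-fresh σ a t ψ (∨-conicalʳ _ _ a∉))
sub-update-fresh σ a t (φ ∨ᶠ ψ) a∉ =
  cong₂ _∨ᶠ_ (sub-update-fresh σ a t φ (∨-conicalˡ _ _ a∉))
             (sub-update-fresh σ a t ψ (∨-conicalʳ _ _ a∉))
sub-update-fresh σ a t (φ ⇒ᶠ ψ) a∉ =
  cong₂ _⇒ᶠ_ (sub-update-fresh σ a t φ (∨-conicalˡ _ _ a∉))
             (sub-update-fresh σ a t ψ (∨-conicalʳ _ _ a∉))
sub-update-fresh σ a t (Fall x φ) a∉ = cong (Fall x) (sub-update-fresh σ a t φ a∉)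
sub-update-fresh σ a t (Fex x φ)  a∉ = cong (Fex x) (sub-update-fresh σ a t φ a∉)

sub-identity : (∀ b → σ b ≡ fv b) → ∀ φ → sub σ φ ≡ φ
sub-identity {σ} σ≗fv (atom P as) = cong (atom P) (trans (map-cong arg as) (map-id as))
  where
  arg : ∀ t → subArg σ t ≡ t
  arg (bv y)      = refl
  arg (tm (cn k)) = refl
  arg (tm (fv b)) = cong tm (σ≗fv b)
sub-identity σ≗fv ⊤ᶠ         = refl
sub-identity σ≗fv (φ ∧ᶠ ψ)   = cong₂ _∧ᶠ_ (sub-identity σ≗fv φ) (sub-identity σ≗fv ψ)
sub-identity σ≗fv (φ ∨ᶠ ψ)   = cong₂ _∨ᶠ_ (sub-identity σ≗fv φ) (sub-identity σ≗fv ψ)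
sub-identity σ≗fv (φ ⇒ᶠ ψ)   = cong₂ _⇒ᶠ_ (sub-identity σ≗fv φ) (sub-identity σ≗fv ψ)
sub-identity σ≗fv (Fall x φ) = cong (Fall x) (sub-identity σ≗fv φ)
sub-identity σ≗fv (Fex x φ)  = cong (Fex x) (sub-identity σ≗fv φ)

sub-fv : ∀ φ → sub fv φ ≡ φ
sub-fv = sub-identity (λ _ → refl)

≔-self : ∀ a φ → sub (a ≔ fv a) φ ≡ φ
≔-self a = sub-identity self
  where
  self : ∀ b → (a ≔ fv a) b ≡ fv b
  self b with a ≡ᵇ b in eq
  ... | true  = cong fv (≡ᵇ-true⇒≡ eq)
  ... | false = refl

sub-update-inst : ∀ σ a t x φ → occ a φ ≡ false →
                  sub (σ [ a ↦ t ]) (φ [ fv a / x ]) ≡ sub σ φ [ t / x ]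
sub-update-inst σ a t x φ a∉ = begin
  sub (σ [ a ↦ t ]) (φ [ fv a / x ])
    ≡⟨ sub-inst (σ [ a ↦ t ]) x (fv a) φ ⟩
  sub (σ [ a ↦ t ]) φ [ (σ [ a ↦ t ]) a / x ]
    ≡⟨ cong₂ (λ χ s → χ [ s / x ]) (sub-update-fresh σ a t φ a∉) updated ⟩
  sub σ φ [ t / x ]
    ∎
  where
  open ≡-Reasoning
  updated : (σ [ a ↦ t ]) a ≡ t
  updated rewrite ≡ᵇ-refl a = refl

≔-inst : ∀ a t x φ → occ a φ ≡ false → sub (a ≔ t) (φ [ fv a / x ]) ≡ φ [ t / x ]
≔-inst a t x φ a∉ = trans (sub-update-inst fv a t x φ a∉) (cong (_[ t / x ]) (sub-fv φ))

depth : Formula → ℕ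
depth (atom P as) = 0
depth ⊤ᶠ          = 0
depth (φ ∧ᶠ ψ)    = suc (depth φ ⊔ depth ψ)
depth (φ ∨ᶠ ψ)    = suc (depth φ ⊔ depth ψ)
depth (φ ⇒ᶠ ψ)    = suc (depth φ ⊔ depth ψ)
depth (Fall x φ)  = suc (depth φ)
depth (Fex x φ)   = suc (depth φ)

depth-sub : ∀ σ φ → depth (sub σ φ) ≡ depth φ
depth-sub σ (atom P as) = refl
depth-sub σ ⊤ᶠ          = refl
depth-sub σ (φ ∧ᶠ ψ)    = cong₂ (λ m n → suc (m ⊔ n)) (depth-sub σ φ) (depth-sub σ ψ)
depth-sub σ (φ ∨ᶠ ψ)    = cong₂ (λ m n → suc (m ⊔ n)) (depth-sub σ φ) (depth-sub σ ψ)
depth-sub σ (φ ⇒ᶠ ψ)    = cong₂ (λ m n → suc (m ⊔ n)) (depth-sub σ φ) (depth-sub σ ψ)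
depth-sub σ (Fall x φ)  = cong suc (depth-sub σ φ)
depth-sub σ (Fex x φ)   = cong suc (depth-sub σ φ)

depth-inst : ∀ x t φ → depth (φ [ t / x ]) ≡ depth φ
depth-inst x t (atom P as) = refl
depth-inst x t ⊤ᶠ          = refl
depth-inst x t (φ ∧ᶠ ψ)    = cong₂ (λ m n → suc (m ⊔ n)) (depth-inst x t φ) (depth-inst x t ψ)
depth-inst x t (φ ∨ᶠ ψ)    = cong₂ (λ m n → suc (m ⊔ n)) (depth-inst x t φ) (depth-inst x t ψ)
depth-inst x t (φ ⇒ᶠ ψ)    = cong₂ (λ m n → suc (m ⊔ n)) (depth-inst x t φ) (depth-inst x t ψ)
depth-inst x t (Fall y φ) with x ≡ᵇ y
... | true  = refl
... | false = cong suc (depth-inst x t φ)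
depth-inst x t (Fex y φ) with x ≡ᵇ y
... | true  = refl
... | false = cong suc (depth-inst x t φ)

-- Closed formulas

closedIn-mono : sc ⊆ sc' → ∀ φ → ClosedIn sc φ → ClosedIn sc' φ
closedIn-mono sc⊆ (atom P as) cl = All.map arg cl
  where
  arg : ∀ {t} → ClosedArg _ t → ClosedArg _ t
  arg {bv y} y∈ = sc⊆ y∈
  arg {tm s} _  = tt
closedIn-mono sc⊆ ⊤ᶠ         _        = tt
closedIn-mono sc⊆ (φ ∧ᶠ ψ)   (cφ , cψ) = closedIn-mono sc⊆ φ cφ , closedIn-mono sc⊆ ψ cψ
closedIn-mono sc⊆ (φ ∨ᶠ ψ)   (cφ , cψ) = closedIn-mono sc⊆ φ cφ , closedIn-mono sc⊆ ψ cψ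
closedIn-mono sc⊆ (φ ⇒ᶠ ψ)   (cφ , cψ) = closedIn-mono sc⊆ φ cφ , closedIn-mono sc⊆ ψ cψ
closedIn-mono sc⊆ (Fall x φ) cl        = closedIn-mono (∷⁺ʳ x sc⊆) φ cl
closedIn-mono sc⊆ (Fex x φ)  cl        = closedIn-mono (∷⁺ʳ x sc⊆) φ cl

closedIn-sub : ∀ σ φ → ClosedIn sc φ → ClosedIn sc (sub σ φ)
closedIn-sub σ (atom P as) cl = map⁺ (All.map arg cl)
  where
  arg : ∀ {t} → ClosedArg _ t → ClosedArg _ (subArg σ t)
  arg {bv y} y∈ = y∈
  arg {tm s} _  = tt
closedIn-sub σ ⊤ᶠ         _        = tt
closedIn-sub σ (φ ∧ᶠ ψ)   (cφ , cψ) = closedIn-sub σ φ cφ , closedIn-sub σ ψ cψ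
closedIn-sub σ (φ ∨ᶠ ψ)   (cφ , cψ) = closedIn-sub σ φ cφ , closedIn-sub σ ψ cψ
closedIn-sub σ (φ ⇒ᶠ ψ)   (cφ , cψ) = closedIn-sub σ φ cφ , closedIn-sub σ ψ cψ
closedIn-sub σ (Fall x φ) cl        = closedIn-sub σ φ cl
closedIn-sub σ (Fex x φ)  cl        = closedIn-sub σ φ cl

∷-swap⊆ : ∀ {A : Set} (x y : A) xs → x ∷ y ∷ xs ⊆ y ∷ x ∷ xs
∷-swap⊆ x y xs = ⊆-reflexive-↭ (↭.swap x y ↭.refl)

∷-dup⊆ : x ≡ y → y ∷ x ∷ sc ⊆ y ∷ sc
∷-dup⊆ {y = y} {sc} x≡y = ∈-∷⁺ʳ (here refl) (∈-∷⁺ʳ (here x≡y) (xs⊆x∷xs sc y))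

closedIn-inst : ∀ x t φ → ClosedIn (x ∷ sc) φ → ClosedIn sc (φ [ t / x ])
closedIn-inst x t (atom P as) cl = args as cl
  where
  args : ∀ as → All (ClosedArg (x ∷ _)) as → All (ClosedArg _) (substArgs x t as)
  args []          []         = []
  args (tm s ∷ as) (_ ∷ cl)   = tt ∷ args as cl
  args (bv y ∷ as) (y∈ ∷ cl) with x ≡ᵇ y in eq
  ... | true  = tt ∷ args as cl
  args (bv y ∷ as) (here y≡x ∷ cl) | false = contradiction (sym y≡x) (≡ᵇ-false⇒≢ eq)
  args (bv y ∷ as) (there y∈ ∷ cl) | false = y∈ ∷ args as cl
closedIn-inst x t ⊤ᶠ         _        = tt
closedIn-inst x t (φ ∧ᶠ ψ)   (cφ , cψ) = closedIn-inst x t φ cφ , closedIn-inst x t ψ cψ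
closedIn-inst x t (φ ∨ᶠ ψ)   (cφ , cψ) = closedIn-inst x t φ cφ , closedIn-inst x t ψ cψ
closedIn-inst x t (φ ⇒ᶠ ψ)   (cφ , cψ) = closedIn-inst x t φ cφ , closedIn-inst x t ψ cψ
closedIn-inst {sc} x t (Fall y φ) cl with x ≡ᵇ y in eq
... | true  = closedIn-mono (∷-dup⊆ (≡ᵇ-true⇒≡ eq)) φ cl
... | false = closedIn-inst x t φ (closedIn-mono (∷-swap⊆ y x sc) φ cl)
closedIn-inst {sc} x t (Fex y φ) cl with x ≡ᵇ y in eq
... | true  = closedIn-mono (∷-dup⊆ (≡ᵇ-true⇒≡ eq)) φ cl
... | false = closedIn-inst x t φ (closedIn-mono (∷-swap⊆ y x sc) φ cl)

closedIn-inst⁻ : ∀ x t φ → ClosedIn sc (φ [ t / x ]) → ClosedIn (x ∷ sc) φ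
closedIn-inst⁻ x t (atom P as) cl = args as cl
  where
  args : ∀ as → All (ClosedArg _) (substArgs x t as) → All (ClosedArg (x ∷ _)) as
  args []          []        = []
  args (tm s ∷ as) (_ ∷ cl)  = tt ∷ args as cl
  args (bv y ∷ as) (c ∷ cl) with x ≡ᵇ y in eq
  ... | true  = here (sym (≡ᵇ-true⇒≡ eq)) ∷ args as cl
  ... | false = there c ∷ args as cl
closedIn-inst⁻ x t ⊤ᶠ         _        = tt
closedIn-inst⁻ x t (φ ∧ᶠ ψ)   (cφ , cψ) = closedIn-inst⁻ x t φ cφ , closedIn-inst⁻ x t ψ cψ
closedIn-inst⁻ x t (φ ∨ᶠ ψ)   (cφ , cψ) = closedIn-inst⁻ x t φ cφ , closedIn-inst⁻ x t ψ cψ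
closedIn-inst⁻ x t (φ ⇒ᶠ ψ)   (cφ , cψ) = closedIn-inst⁻ x t φ cφ , closedIn-inst⁻ x t ψ cψ
closedIn-inst⁻ {sc} x t (Fall y φ) cl with x ≡ᵇ y
... | true  = closedIn-mono (∷⁺ʳ y (xs⊆x∷xs sc x)) φ cl
... | false = closedIn-mono (∷-swap⊆ x y sc) φ (closedIn-inst⁻ x t φ cl)
closedIn-inst⁻ {sc} x t (Fex y φ) cl with x ≡ᵇ y
... | true  = closedIn-mono (∷⁺ʳ y (xs⊆x∷xs sc x)) φ cl
... | false = closedIn-mono (∷-swap⊆ x y sc) φ (closedIn-inst⁻ x t φ cl)

-- Fresh and bound variables

maxFreeArgs : List Arg → ℕ
maxFreeArgs []               = 0
maxFreeArgs (tm (fv a) ∷ as) = a ⊔ maxFreeArgs as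
maxFreeArgs (_ ∷ as)         = maxFreeArgs as

maxFree : Formula → ℕ
maxFree (atom P as) = maxFreeArgs as
maxFree ⊤ᶠ          = 0
maxFree (φ ∧ᶠ ψ)    = maxFree φ ⊔ maxFree ψ
maxFree (φ ∨ᶠ ψ)    = maxFree φ ⊔ maxFree ψ
maxFree (φ ⇒ᶠ ψ)    = maxFree φ ⊔ maxFree ψ
maxFree (Fall x φ)  = maxFree φ
maxFree (Fex x φ)   = maxFree φ

maxFreeList : List Formula → ℕ
maxFreeList []      = 0
maxFreeList (φ ∷ Γ) = maxFree φ ⊔ maxFreeList Γ

maxFree<⇒fresh : ∀ φ → maxFree φ < c → occ c φ ≡ false
maxFree<⇒fresh {c} (atom P as) bound = args as bound
  where
  args : ∀ as → maxFreeArgs as < c → occArgs c as ≡ false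
  args []               _     = refl
  args (bv y ∷ as)      bound = args as bound
  args (tm (cn k) ∷ as) bound = args as bound
  args (tm (fv a) ∷ as) bound =
    cong₂ _∨_ (≢⇒≡ᵇ-false (>⇒≢ (m⊔n<o⇒m<o a _ bound))) (args as (m⊔n<o⇒n<o a _ bound))
maxFree<⇒fresh ⊤ᶠ         _     = refl
maxFree<⇒fresh (φ ∧ᶠ ψ)   bound =
  cong₂ _∨_ (maxFree<⇒fresh φ (m⊔n<o⇒m<o _ _ bound)) (maxFree<⇒fresh ψ (m⊔n<o⇒n<o _ _ bound))
maxFree<⇒fresh (φ ∨ᶠ ψ)   bound =
  cong₂ _∨_ (maxFree<⇒fresh φ (m⊔n<o⇒m<o _ _ bound)) (maxFree<⇒fresh ψ (m⊔n<o⇒n<o _ _ bound))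
maxFree<⇒fresh (φ ⇒ᶠ ψ)   bound =
  cong₂ _∨_ (maxFree<⇒fresh φ (m⊔n<o⇒m<o _ _ bound)) (maxFree<⇒fresh ψ (m⊔n<o⇒n<o _ _ bound))
maxFree<⇒fresh (Fall x φ) bound = maxFree<⇒fresh φ bound
maxFree<⇒fresh (Fex x φ)  bound = maxFree<⇒fresh φ bound

maxFreeList<⇒fresh : ∀ Γ → maxFreeList Γ < c → FreshL c Γ
maxFreeList<⇒fresh []      _     = []
maxFreeList<⇒fresh (φ ∷ Γ) bound =
  maxFree<⇒fresh φ (m⊔n<o⇒m<o _ _ bound) ∷ maxFreeList<⇒fresh Γ (m⊔n<o⇒n<o _ _ bound)

freshVar : ℕ → List Formula → ℕ
freshVar k Γ = suc (k ⊔ maxFreeList Γ)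

freshVar-> : ∀ k Γ → k < freshVar k Γ
freshVar-> k Γ = m⊔n<o⇒m<o k _ ≤-refl

freshVar-fresh : ∀ k Γ → FreshL (freshVar k Γ) Γ
freshVar-fresh k Γ = maxFreeList<⇒fresh Γ (m⊔n<o⇒n<o k _ ≤-refl)

maxBoundArgs : List Arg → ℕ
maxBoundArgs []          = 0
maxBoundArgs (bv y ∷ as) = y ⊔ maxBoundArgs as
maxBoundArgs (tm _ ∷ as) = maxBoundArgs as

maxBound : Formula → ℕ
maxBound (atom P as) = maxBoundArgs as
maxBound ⊤ᶠ          = 0
maxBound (φ ∧ᶠ ψ)    = maxBound φ ⊔ maxBound ψ
maxBound (φ ∨ᶠ ψ)    = maxBound φ ⊔ maxBound ψ
maxBound (φ ⇒ᶠ ψ)    = maxBound φ ⊔ maxBound ψ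
maxBound (Fall x φ)  = x ⊔ maxBound φ
maxBound (Fex x φ)   = x ⊔ maxBound φ

abstractArg : ℕ → ℕ → Arg → Arg
abstractArg a y (tm (fv b)) = if a ≡ᵇ b then bv y else tm (fv b)
abstractArg a y t           = t

abstractFv : ℕ → ℕ → Formula → Formula
abstractFv a y (atom P as) = atom P (map (abstractArg a y) as)
abstractFv a y ⊤ᶠ          = ⊤ᶠ
abstractFv a y (φ ∧ᶠ ψ)    = abstractFv a y φ ∧ᶠ abstractFv a y ψ
abstractFv a y (φ ∨ᶠ ψ)    = abstractFv a y φ ∨ᶠ abstractFv a y ψ
abstractFv a y (φ ⇒ᶠ ψ)    = abstractFv a y φ ⇒ᶠ abstractFv a y ψ
abstractFv a y (Fall x φ)  = Fall x (abstractFv a y φ)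
abstractFv a y (Fex x φ)   = Fex x (abstractFv a y φ)

abstractFv-inst : ∀ a y t φ → maxBound φ < y → abstractFv a y φ [ t / y ] ≡ sub (a ≔ t) φ
abstractFv-inst a y t (atom P as) bound = cong (atom P) (args as bound)
  where
  args : ∀ as → maxBoundArgs as < y →
         substArgs y t (map (abstractArg a y) as) ≡ map (subArg (a ≔ t)) as
  args []               _ = refl
  args (bv z ∷ as)      bound rewrite ≢⇒≡ᵇ-false (>⇒≢ (m⊔n<o⇒m<o z _ bound)) =
    cong (bv z ∷_) (args as (m⊔n<o⇒n<o z _ bound))
  args (tm (cn k) ∷ as) bound = cong (tm (cn k) ∷_) (args as bound)
  args (tm (fv b) ∷ as) bound with a ≡ᵇ b
  ... | true rewrite ≡ᵇ-refl y = cong (tm t ∷_) (args as bound)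
  ... | false                  = cong (tm (fv b) ∷_) (args as bound)
abstractFv-inst a y t ⊤ᶠ _ = refl
abstractFv-inst a y t (φ ∧ᶠ ψ) bound =
  cong₂ _∧ᶠ_ (abstractFv-inst a y t φ (m⊔n<o⇒m<o _ _ bound))
             (abstractFv-inst a y t ψ (m⊔n<o⇒n<o _ _ bound))
abstractFv-inst a y t (φ ∨ᶠ ψ) bound =
  cong₂ _∨ᶠ_ (abstractFv-inst a y t φ (m⊔n<o⇒m<o _ _ bound))
             (abstractFv-inst a y t ψ (m⊔n<o⇒n<o _ _ bound))
abstractFv-inst a y t (φ ⇒ᶠ ψ) bound =
  cong₂ _⇒ᶠ_ (abstractFv-inst a y t φ (m⊔n<o⇒m<o _ _ bound))
             (abstractFv-inst a y t ψ (m⊔n<o⇒n<o _ _ bound))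
abstractFv-inst a y t (Fall x φ) bound rewrite ≢⇒≡ᵇ-false (>⇒≢ (m⊔n<o⇒m<o x _ bound)) =
  cong (Fall x) (abstractFv-inst a y t φ (m⊔n<o⇒n<o x _ bound))
abstractFv-inst a y t (Fex x φ) bound rewrite ≢⇒≡ᵇ-false (>⇒≢ (m⊔n<o⇒m<o x _ bound)) =
  cong (Fex x) (abstractFv-inst a y t φ (m⊔n<o⇒n<o x _ bound))

abstractFv-fresh : ∀ a y φ → occ a (abstractFv a y φ) ≡ false
abstractFv-fresh a y (atom P as) = args as
  where
  args : ∀ as → occArgs a (map (abstractArg a y) as) ≡ false
  args []               = refl
  args (bv z ∷ as)      = args as
  args (tm (cn k) ∷ as) = args as
  args (tm (fv b) ∷ as) with a ≡ᵇ b in eq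
  ... | true  = args as
  ... | false = cong₂ _∨_ eq (args as)
abstractFv-fresh a y ⊤ᶠ         = refl
abstractFv-fresh a y (φ ∧ᶠ ψ)   = cong₂ _∨_ (abstractFv-fresh a y φ) (abstractFv-fresh a y ψ)
abstractFv-fresh a y (φ ∨ᶠ ψ)   = cong₂ _∨_ (abstractFv-fresh a y φ) (abstractFv-fresh a y ψ)
abstractFv-fresh a y (φ ⇒ᶠ ψ)   = cong₂ _∨_ (abstractFv-fresh a y φ) (abstractFv-fresh a y ψ)
abstractFv-fresh a y (Fall x φ) = abstractFv-fresh a y φ
abstractFv-fresh a y (Fex x φ)  = abstractFv-fresh a y φ

Harrop-sub : ∀ σ → Harrop φ → Harrop (sub σ φ)
Harrop-sub σ h⊤           = h⊤
Harrop-sub σ (hatom P as) = hatom P _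
Harrop-sub σ (h∧ hφ hψ)   = h∧ (Harrop-sub σ hφ) (Harrop-sub σ hψ)
Harrop-sub σ (h⇒ hψ)      = h⇒ (Harrop-sub σ hψ)
Harrop-sub σ (h∀ hφ)      = h∀ (Harrop-sub σ hφ)

Harrop-inst : ∀ x t → Harrop φ → Harrop (φ [ t / x ])
Harrop-inst x t h⊤           = h⊤
Harrop-inst x t (hatom P as) = hatom P _
Harrop-inst x t (h∧ hφ hψ)   = h∧ (Harrop-inst x t hφ) (Harrop-inst x t hψ)
Harrop-inst x t (h⇒ hψ)      = h⇒ (Harrop-inst x t hψ)
Harrop-inst x t (h∀ {y} hφ) with x ≡ᵇ y
... | true  = h∀ hφ
... | false = h∀ (Harrop-inst x t hφ)

-- Derivations

mk≈ˢ : Γ ⊆ Γ' → Γ' ⊆ Γ → Γ ≈ˢ Γ'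
mk≈ˢ Γ⊆Γ' Γ'⊆Γ _ = Γ⊆Γ' , Γ'⊆Γ

≈ˢ⇒⊆ : Γ ≈ˢ Γ' → Γ ⊆ Γ'
≈ˢ⇒⊆ Γ≈Γ' = proj₁ (Γ≈Γ' _)

≈ˢ⇒⊇ : Γ ≈ˢ Γ' → Γ' ⊆ Γ
≈ˢ⇒⊇ Γ≈Γ' = proj₂ (Γ≈Γ' _)

≈ˢ-refl : Γ ≈ˢ Γ
≈ˢ-refl = mk≈ˢ ⊆-refl ⊆-refl

≈ˢ-swap : ∀ φ ψ Γ → (φ ∷ ψ ∷ Γ) ≈ˢ (ψ ∷ φ ∷ Γ)
≈ˢ-swap φ ψ Γ = mk≈ˢ (∷-swap⊆ φ ψ Γ) (∷-swap⊆ ψ φ Γ)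

≈ˢ-++-idem : ∀ Γ → (Γ ++ Γ) ≈ˢ Γ
≈ˢ-++-idem Γ = mk≈ˢ (reduce ∘ ∈-++⁻ Γ) (xs⊆xs++ys Γ Γ)

≈ˢ-∷-absorb : φ ∈ Γ → (φ ∷ Γ) ≈ˢ Γ
≈ˢ-∷-absorb {Γ = Γ} φ∈Γ = mk≈ˢ (∈-∷⁺ʳ φ∈Γ ⊆-refl) (xs⊆x∷xs Γ _)

⊢ᴹ-weakenʳ : Closed ψ → Γ ⊢ᴹ [ φ ] → Γ ⊢ᴹ φ ∷ ψ ∷ []
⊢ᴹ-weakenʳ {ψ} {Γ} {φ} cψ d = subst (_⊢ᴹ φ ∷ ψ ∷ []) (++-identityʳ Γ) (weak [] (cψ ∷ []) d)

⊢ᴹ-closed : Γ ⊢ᴹ Δ → All Closed Γ × All Closed Δ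
⊢ᴹ-closed (ax cφ) = cφ ∷ [] , cφ ∷ []
⊢ᴹ-closed ax⊤     = [] , tt ∷ []
⊢ᴹ-closed (∧L d) with ⊢ᴹ-closed d
... | cφ ∷ cψ ∷ cΓ , cΔ = (cφ , cψ) ∷ cΓ , cΔ
⊢ᴹ-closed (∧R d e) with ⊢ᴹ-closed d | ⊢ᴹ-closed e
... | cΓ , cφ ∷ cΔ | _ , cψ ∷ _ = cΓ , (cφ , cψ) ∷ cΔ
⊢ᴹ-closed (∨L d e) with ⊢ᴹ-closed d | ⊢ᴹ-closed e
... | cφ ∷ cΓ , cΔ | cψ ∷ _ , _ = (cφ , cψ) ∷ cΓ , cΔ
⊢ᴹ-closed (∨R d) with ⊢ᴹ-closed d
... | cΓ , cφ ∷ cψ ∷ cΔ = cΓ , (cφ , cψ) ∷ cΔ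
⊢ᴹ-closed (⇒L d e) with ⊢ᴹ-closed d | ⊢ᴹ-closed e
... | cψ ∷ cΓ , cΔ | _ , cφ ∷ _ = (cφ , cψ) ∷ cΓ , cΔ
⊢ᴹ-closed (⇒Rp cφ d) with ⊢ᴹ-closed d
... | cΓ , cψ ∷ cΔ = cΓ , (cφ , cψ) ∷ cΔ
⊢ᴹ-closed (∀R {x = x} {φ} a _ _ d) with ⊢ᴹ-closed d
... | cΓ , cφa ∷ cΔ = cΓ , closedIn-inst⁻ x (fv a) φ cφa ∷ cΔ
⊢ᴹ-closed (∀L {x = x} {φ} u d) with ⊢ᴹ-closed d
... | cφu ∷ cΓ , cΔ = closedIn-inst⁻ x u φ cφu ∷ cΓ , cΔ
⊢ᴹ-closed (∃R {x = x} {φ} u d) with ⊢ᴹ-closed d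
... | cΓ , cφu ∷ cΔ = cΓ , closedIn-inst⁻ x u φ cφu ∷ cΔ
⊢ᴹ-closed (∃L {x = x} {φ} a _ _ d) with ⊢ᴹ-closed d
... | cφa ∷ cΓ , cΔ = closedIn-inst⁻ x (fv a) φ cφa ∷ cΓ , cΔ
⊢ᴹ-closed (weak cΓ₁ cΔ₁ d) with ⊢ᴹ-closed d
... | cΓ , cΔ = ++⁺ cΓ cΓ₁ , ++⁺ cΔ cΔ₁
⊢ᴹ-closed (cut _ d e) with ⊢ᴹ-closed d | ⊢ᴹ-closed e
... | cΓ , _ ∷ cΔ | _ ∷ cΓ₁ , cΔ₁ = ++⁺ cΓ cΓ₁ , ++⁺ cΔ cΔ₁
⊢ᴹ-closed (sets Γ≈Γ' Δ≈Δ' d) with ⊢ᴹ-closed d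
... | cΓ , cΔ = All-resp-⊇ (≈ˢ⇒⊇ Γ≈Γ') cΓ , All-resp-⊇ (≈ˢ⇒⊇ Δ≈Δ') cΔ

⊢ᴹ-∨ˡ : Closed ψ → Γ ⊢ᴹ [ φ ] → Γ ⊢ᴹ [ φ ∨ᶠ ψ ]
⊢ᴹ-∨ˡ cψ d = ∨R (⊢ᴹ-weakenʳ cψ d)

⊢ᴹ-∨ʳ : Closed φ → Γ ⊢ᴹ [ ψ ] → Γ ⊢ᴹ [ φ ∨ᶠ ψ ]
⊢ᴹ-∨ʳ {φ} {ψ = ψ} cφ d = ∨R (sets ≈ˢ-refl (≈ˢ-swap ψ φ []) (⊢ᴹ-weakenʳ cφ d))

⊢ᴹ-closed-conclusion : Γ ⊢ᴹ φ ∷ Δ → Closed φ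
⊢ᴹ-closed-conclusion = All.head ∘ proj₂ ∘ ⊢ᴹ-closed

⊢ᴵ⇒⊢ᴹ : Γ ⊢ᴵ θ → Γ ⊢ᴹ [ θ ]
⊢ᴵ⇒⊢ᴹ (ax cφ)                = ax cφ
⊢ᴵ⇒⊢ᴹ ax⊤                    = ax⊤
⊢ᴵ⇒⊢ᴹ (∧L d)                 = ∧L (⊢ᴵ⇒⊢ᴹ d)
⊢ᴵ⇒⊢ᴹ (∧R d e)               = ∧R (⊢ᴵ⇒⊢ᴹ d) (⊢ᴵ⇒⊢ᴹ e)
⊢ᴵ⇒⊢ᴹ (∨L d e)               = ∨L (⊢ᴵ⇒⊢ᴹ d) (⊢ᴵ⇒⊢ᴹ e)
⊢ᴵ⇒⊢ᴹ (∨R₁ cψ d)             = ⊢ᴹ-∨ˡ cψ (⊢ᴵ⇒⊢ᴹ d)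
⊢ᴵ⇒⊢ᴹ (∨R₂ cφ d)             = ⊢ᴹ-∨ʳ cφ (⊢ᴵ⇒⊢ᴹ d)
⊢ᴵ⇒⊢ᴹ (⇒L d e)               =
  ⇒L (⊢ᴵ⇒⊢ᴹ d) (⊢ᴹ-weakenʳ (⊢ᴹ-closed-conclusion (⊢ᴵ⇒⊢ᴹ d)) (⊢ᴵ⇒⊢ᴹ e))
⊢ᴵ⇒⊢ᴹ (⇒Rp cφ d)             = ⇒Rp cφ (⊢ᴵ⇒⊢ᴹ d)
⊢ᴵ⇒⊢ᴹ (∀R a (a∉ ∷ a∉Γ) d)    = ∀R a a∉Γ (a∉ ∷ []) (⊢ᴵ⇒⊢ᴹ d)
⊢ᴵ⇒⊢ᴹ (∀L u d)               = ∀L u (⊢ᴵ⇒⊢ᴹ d)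
⊢ᴵ⇒⊢ᴹ (∃R u d)               = ∃R u (⊢ᴵ⇒⊢ᴹ d)
⊢ᴵ⇒⊢ᴹ (∃L a (a∉θ ∷ a∉Γ) d)   = ∃L a a∉Γ (a∉θ ∷ []) (⊢ᴵ⇒⊢ᴹ d)
⊢ᴵ⇒⊢ᴹ (weak cΓ₁ d)           = weak cΓ₁ [] (⊢ᴵ⇒⊢ᴹ d)
⊢ᴵ⇒⊢ᴹ (cut cφ d e)           = cut cφ (⊢ᴵ⇒⊢ᴹ d) (⊢ᴵ⇒⊢ᴹ e)
⊢ᴵ⇒⊢ᴹ (sets Γ≈Γ' d)          = sets Γ≈Γ' ≈ˢ-refl (⊢ᴵ⇒⊢ᴹ d)

-- Aczel's slash

Inst : Set
Inst = List (ℕ × Term)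

sub* : Inst → Formula → Formula
sub* []             φ = φ
sub* ((a , t) ∷ ts) φ = sub* ts (sub (a ≔ t) φ)

depth-sub* : ∀ ts φ → depth (sub* ts φ) ≡ depth φ
depth-sub* []             φ = refl
depth-sub* ((a , t) ∷ ts) φ = trans (depth-sub* ts _) (depth-sub (a ≔ t) φ)

sub*-⇒ : ∀ ts φ ψ → sub* ts (φ ⇒ᶠ ψ) ≡ (sub* ts φ ⇒ᶠ sub* ts ψ)
sub*-⇒ []             φ ψ = refl
sub*-⇒ ((a , t) ∷ ts) φ ψ = sub*-⇒ ts _ _

Harrop-sub* : ∀ ts → Harrop φ → Harrop (sub* ts φ)
Harrop-sub* []             h = h
Harrop-sub* ((a , t) ∷ ts) h = Harrop-sub* ts (Harrop-sub (a ≔ t) h)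

m<1+m⊔n : ∀ m n → m < suc (m ⊔ n)
m<1+m⊔n m n = s≤s (m≤m⊔n m n)

n<1+m⊔n : ∀ m n → n < suc (m ⊔ n)
n<1+m⊔n m n = s≤s (m≤n⊔m m n)

1+m⊔n<1+o⇒m<o : ∀ {m n o} → suc (m ⊔ n) < suc o → m < o
1+m⊔n<1+o⇒m<o = m⊔n<o⇒m<o _ _ ∘ s≤s⁻¹

1+m⊔n<1+o⇒n<o : ∀ {m n o} → suc (m ⊔ n) < suc o → n < o
1+m⊔n<1+o⇒n<o = m⊔n<o⇒n<o _ _ ∘ s≤s⁻¹

depth-inst-< : ∀ x t φ → depth φ < n → depth (φ [ t / x ]) < n
depth-inst-< {n} x t φ = subst (_< n) (sym (depth-inst x t φ))

depth-sub*-< : ∀ ts φ → depth φ < n → depth (sub* ts φ) < n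
depth-sub*-< {n} ts φ = subst (_< n) (sym (depth-sub* ts φ))

-- ⇒-intro is the rule ⇒Rp, which does not discharge φ.
record Provability (Γ₀ : List Formula) : Set₁ where
  infix 3 ⊢_
  field
    ⊢_         : Formula → Set
    assumption : φ ∈ Γ₀ → ⊢ φ
    ⊤-intro    : ⊢ ⊤ᶠ
    ∧-intro    : ⊢ φ → ⊢ ψ → ⊢ φ ∧ᶠ ψ
    ∧-elimˡ    : ⊢ φ ∧ᶠ ψ → ⊢ φ
    ∧-elimʳ    : ⊢ φ ∧ᶠ ψ → ⊢ ψ
    ∨-introˡ   : Closed ψ → ⊢ φ → ⊢ φ ∨ᶠ ψ
    ∨-introʳ   : Closed φ → ⊢ ψ → ⊢ φ ∨ᶠ ψ
    ⇒-intro    : Closed φ → ⊢ ψ → ⊢ φ ⇒ᶠ ψ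
    ⇒-elim     : ⊢ φ ⇒ᶠ ψ → ⊢ φ → ⊢ ψ
    ∀-intro    : ∀ a → FreshL a Γ₀ → occ a φ ≡ false → ⊢ φ [ fv a / x ] → ⊢ Fall x φ
    ∀-elim     : ∀ u → ⊢ Fall x φ → ⊢ φ [ u / x ]
    ∃-intro    : ∀ u → ⊢ φ [ u / x ] → ⊢ Fex x φ

module AczelSlash {Γ₀ : List Formula} (prov : Provability Γ₀) where
  open Provability prov

  Admissible : Inst → Set
  Admissible = All (λ (a , _) → FreshL a Γ₀)

  -- a is an eigenvariable for Γ₀: generalise over it through a bound variable v that does
  -- not occur in φ, then instantiate at t.
  ⊢-sub-fresh : FreshL a Γ₀ → ⊢ φ → ⊢ sub (a ≔ t) φ
  ⊢-sub-fresh {a} {φ} {t} a∉Γ₀ ⊢φ =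
    subst ⊢_ (abstractFv-inst a v t φ ≤-refl)
      (∀-elim t (∀-intro {φ = abstractFv a v φ} {x = v} a a∉Γ₀ (abstractFv-fresh a v φ)
                                                         (subst ⊢_ (sym φ-back) ⊢φ)))
    where
    v : ℕ
    v = suc (maxBound φ)
    φ-back : abstractFv a v φ [ fv a / v ] ≡ φ
    φ-back = trans (abstractFv-inst a v (fv a) φ ≤-refl) (≔-self a φ)

  ⊢-sub* : ∀ ts → Admissible ts → ⊢ φ → ⊢ sub* ts φ
  ⊢-sub* []             []         ⊢φ = ⊢φ
  ⊢-sub* ((a , t) ∷ ts) (a∉ ∷ adm) ⊢φ = ⊢-sub* ts adm (⊢-sub-fresh a∉ ⊢φ)

  -- The fuel n only serves termination; any n > depth φ gives the same slash (Slash-fuel).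
  -- Atoms need nothing beyond provability, which Slashed adds. The implication clause
  -- ranges over later substitutions for variables not free in Γ₀, which makes the slash
  -- stable under them (Slash-sub), as ∀-introduction requires.
  Slash : ℕ → Formula → Set
  Slash zero    _           = ⊤
  Slash (suc n) (atom P as) = ⊤
  Slash (suc n) ⊤ᶠ          = ⊤
  Slash (suc n) (φ ∧ᶠ ψ)    = Slash n φ × Slash n ψ
  Slash (suc n) (φ ∨ᶠ ψ)    = (⊢ φ × Slash n φ) ⊎ (⊢ ψ × Slash n ψ)
  Slash (suc n) (φ ⇒ᶠ ψ)    = ∀ ts → Admissible ts → ⊢ sub* ts φ → Slash n (sub* ts ψ)
  Slash (suc n) (Fall x φ)  = ∀ u → Slash n (φ [ u / x ])
  Slash (suc n) (Fex x φ)   = ∃[ u ] (⊢ φ [ u / x ] × Slash n (φ [ u / x ]))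

  Slash-fuel : ∀ {m n} φ → depth φ < m → depth φ < n → Slash m φ → Slash n φ
  Slash-fuel {suc m} {suc n} (atom P as) _ _ _ = tt
  Slash-fuel {suc m} {suc n} ⊤ᶠ          _ _ _ = tt
  Slash-fuel {suc m} {suc n} (φ ∧ᶠ ψ) dm dn (sφ , sψ) =
    Slash-fuel φ (1+m⊔n<1+o⇒m<o dm) (1+m⊔n<1+o⇒m<o dn) sφ ,
    Slash-fuel ψ (1+m⊔n<1+o⇒n<o dm) (1+m⊔n<1+o⇒n<o dn) sψ
  Slash-fuel {suc m} {suc n} (φ ∨ᶠ ψ) dm dn (inj₁ (⊢φ , sφ)) =
    inj₁ (⊢φ , Slash-fuel φ (1+m⊔n<1+o⇒m<o dm) (1+m⊔n<1+o⇒m<o dn) sφ)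
  Slash-fuel {suc m} {suc n} (φ ∨ᶠ ψ) dm dn (inj₂ (⊢ψ , sψ)) =
    inj₂ (⊢ψ , Slash-fuel ψ (1+m⊔n<1+o⇒n<o dm) (1+m⊔n<1+o⇒n<o dn) sψ)
  Slash-fuel {suc m} {suc n} (φ ⇒ᶠ ψ) dm dn s ts adm ⊢φ =
    Slash-fuel (sub* ts ψ) (depth-sub*-< ts ψ (1+m⊔n<1+o⇒n<o dm)) (depth-sub*-< ts ψ (1+m⊔n<1+o⇒n<o dn))
      (s ts adm ⊢φ)
  Slash-fuel {suc m} {suc n} (Fall x φ) dm dn s u =
    Slash-fuel (φ [ u / x ]) (depth-inst-< x u φ (s≤s⁻¹ dm)) (depth-inst-< x u φ (s≤s⁻¹ dn)) (s u)
  Slash-fuel {suc m} {suc n} (Fex x φ) dm dn (u , ⊢φu , sφu) =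
    u , ⊢φu , Slash-fuel (φ [ u / x ]) (depth-inst-< x u φ (s≤s⁻¹ dm)) (depth-inst-< x u φ (s≤s⁻¹ dn)) sφu

  Slash-from-depth : ∀ φ → depth φ < n → Slash (suc (depth φ)) φ → Slash n φ
  Slash-from-depth φ dn = Slash-fuel φ ≤-refl dn

  Slash-to-depth : ∀ φ → depth φ < n → Slash n φ → Slash (suc (depth φ)) φ
  Slash-to-depth φ dn = Slash-fuel φ dn ≤-refl

  Slash-sub : ∀ n a t φ → FreshL a Γ₀ → Slash n φ → Slash n (sub (a ≔ t) φ)
  Slash-sub zero    a t φ           a∉ _ = tt
  Slash-sub (suc n) a t (atom P as) a∉ _ = tt
  Slash-sub (suc n) a t ⊤ᶠ          a∉ _ = tt
  Slash-sub (suc n) a t (φ ∧ᶠ ψ)    a∉ (sφ , sψ) = Slash-sub n a t φ a∉ sφ , Slash-sub n a t ψ a∉ sψ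
  Slash-sub (suc n) a t (φ ∨ᶠ ψ)    a∉ (inj₁ (⊢φ , sφ)) =
    inj₁ (⊢-sub-fresh a∉ ⊢φ , Slash-sub n a t φ a∉ sφ)
  Slash-sub (suc n) a t (φ ∨ᶠ ψ)    a∉ (inj₂ (⊢ψ , sψ)) =
    inj₂ (⊢-sub-fresh a∉ ⊢ψ , Slash-sub n a t ψ a∉ sψ)
  Slash-sub (suc n) a t (φ ⇒ᶠ ψ)    a∉ s ts adm = s ((a , t) ∷ ts) (a∉ ∷ adm)
  Slash-sub (suc n) a t (Fex x φ)   a∉ (u , ⊢φu , sφu) =
    subTerm (a ≔ t) u , subst ⊢_ (sub-inst (a ≔ t) x u φ) (⊢-sub-fresh a∉ ⊢φu) ,
    subst (Slash n) (sub-inst (a ≔ t) x u φ) (Slash-sub n a t (φ [ u / x ]) a∉ sφu)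
  -- u may be fv a itself, so instantiate at a variable e fresh for everything first and
  -- substitute u for e afterwards.
  Slash-sub (suc n) a t (Fall x φ)  a∉ s u =
    subst (Slash n) (≔-inst e u x φ′ (All.head e-fresh))
      (Slash-sub n e u (φ′ [ fv e / x ]) (All.tail e-fresh)
        (subst (Slash n) sub-inst-e (Slash-sub n a t _ a∉ (s (fv e)))))
    where
    φ′ : Formula
    φ′ = sub (a ≔ t) φ
    e : ℕ
    e = freshVar a (φ′ ∷ Γ₀)
    e-fresh : FreshL e (φ′ ∷ Γ₀)
    e-fresh = freshVar-fresh a (φ′ ∷ Γ₀)
    sub-inst-e : sub (a ≔ t) (φ [ fv e / x ]) ≡ φ′ [ fv e / x ]
    sub-inst-e rewrite sub-inst (a ≔ t) x (fv e) φ
                     | ≢⇒≡ᵇ-false (<⇒≢ (freshVar-> a (φ′ ∷ Γ₀))) = refl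

  Slash-harrop : ∀ n → Harrop φ → ⊢ φ → Slash n φ
  Slash-harrop zero    _            _ = tt
  Slash-harrop (suc n) h⊤           _ = tt
  Slash-harrop (suc n) (hatom P as) _ = tt
  Slash-harrop (suc n) (h∧ hφ hψ) ⊢φψ =
    Slash-harrop n hφ (∧-elimˡ ⊢φψ) , Slash-harrop n hψ (∧-elimʳ ⊢φψ)
  Slash-harrop (suc n) (h⇒ {φ} {ψ} hψ) ⊢φ⇒ψ ts adm ⊢φ =
    Slash-harrop n (Harrop-sub* ts hψ) (⇒-elim (subst ⊢_ (sub*-⇒ ts φ ψ) (⊢-sub* ts adm ⊢φ⇒ψ)) ⊢φ)
  Slash-harrop (suc n) (h∀ {x} hφ) ⊢∀ u = Slash-harrop n (Harrop-inst x u hφ) (∀-elim u ⊢∀)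

  Slashed : Formula → Set
  Slashed φ = ⊢ φ × Slash (suc (depth φ)) φ

  Slashed-harrop : Harrop φ → ⊢ φ → Slashed φ
  Slashed-harrop h ⊢φ = ⊢φ , Slash-harrop _ h ⊢φ

  Slashed-sub : FreshL a Γ₀ → Slashed φ → Slashed (sub (a ≔ t) φ)
  Slashed-sub {a} {φ} {t} a∉ (⊢φ , sφ) =
    ⊢-sub-fresh a∉ ⊢φ ,
    Slash-to-depth _ (s≤s (≤-reflexive (depth-sub (a ≔ t) φ))) (Slash-sub _ a t φ a∉ sφ)

  Slashed-sub* : ∀ ts → Admissible ts → Slashed φ → Slashed (sub* ts φ)
  Slashed-sub* []             []         s = s
  Slashed-sub* ((a , t) ∷ ts) (a∉ ∷ adm) s = Slashed-sub* ts adm (Slashed-sub a∉ s)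

  Slashed-⊤ : Slashed ⊤ᶠ
  Slashed-⊤ = ⊤-intro , tt

  Slashed-∧ : Slashed φ → Slashed ψ → Slashed (φ ∧ᶠ ψ)
  Slashed-∧ {φ} {ψ} (⊢φ , sφ) (⊢ψ , sψ) =
    ∧-intro ⊢φ ⊢ψ , Slash-from-depth φ (m<1+m⊔n _ _) sφ , Slash-from-depth ψ (n<1+m⊔n _ _) sψ

  Slashed-∧⁻ : Slashed (φ ∧ᶠ ψ) → Slashed φ × Slashed ψ
  Slashed-∧⁻ {φ} {ψ} (⊢φψ , sφ , sψ) =
    (∧-elimˡ ⊢φψ , Slash-to-depth φ (m<1+m⊔n _ _) sφ) ,
    (∧-elimʳ ⊢φψ , Slash-to-depth ψ (n<1+m⊔n _ _) sψ)

  Slashed-∨ˡ : Closed ψ → Slashed φ → Slashed (φ ∨ᶠ ψ)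
  Slashed-∨ˡ {φ = φ} cψ (⊢φ , sφ) =
    ∨-introˡ cψ ⊢φ , inj₁ (⊢φ , Slash-from-depth φ (m<1+m⊔n _ _) sφ)

  Slashed-∨ʳ : Closed φ → Slashed ψ → Slashed (φ ∨ᶠ ψ)
  Slashed-∨ʳ {ψ = ψ} cφ (⊢ψ , sψ) =
    ∨-introʳ cφ ⊢ψ , inj₂ (⊢ψ , Slash-from-depth ψ (n<1+m⊔n _ _) sψ)

  Slashed-∨⁻ : Slashed (φ ∨ᶠ ψ) → Slashed φ ⊎ Slashed ψ
  Slashed-∨⁻ {φ} (_ , inj₁ (⊢φ , sφ)) = inj₁ (⊢φ , Slash-to-depth φ (m<1+m⊔n _ _) sφ)
  Slashed-∨⁻ {φ} {ψ} (_ , inj₂ (⊢ψ , sψ)) = inj₂ (⊢ψ , Slash-to-depth ψ (n<1+m⊔n (depth φ) _) sψ)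

  Slashed-⇒ : Closed φ → Slashed ψ → Slashed (φ ⇒ᶠ ψ)
  Slashed-⇒ {φ} {ψ} cφ (⊢ψ , sψ) = ⇒-intro cφ ⊢ψ , λ ts adm _ →
    Slash-from-depth (sub* ts ψ) (depth-sub*-< ts ψ (n<1+m⊔n (depth φ) _))
      (proj₂ (Slashed-sub* ts adm (⊢ψ , sψ)))

  Slashed-⇒⁻ : Slashed (φ ⇒ᶠ ψ) → ⊢ φ → Slashed ψ
  Slashed-⇒⁻ {φ} {ψ} (⊢φ⇒ψ , s) ⊢φ =
    ⇒-elim ⊢φ⇒ψ ⊢φ , Slash-to-depth ψ (n<1+m⊔n (depth φ) _) (s [] [] ⊢φ)

  Slashed-∀ : ∀ a → FreshL a Γ₀ → occ a φ ≡ false → Slashed (φ [ fv a / x ]) → Slashed (Fall x φ)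
  Slashed-∀ {φ} {x} a a∉Γ₀ a∉φ s = ∀-intro a a∉Γ₀ a∉φ (proj₁ s) , λ u →
    Slash-from-depth (φ [ u / x ]) (depth-inst-< x u φ ≤-refl)
      (proj₂ (subst Slashed (≔-inst a u x φ a∉φ) (Slashed-sub a∉Γ₀ s)))

  Slashed-∀⁻ : ∀ u → Slashed (Fall x φ) → Slashed (φ [ u / x ])
  Slashed-∀⁻ {x} {φ} u (⊢∀ , s) =
    ∀-elim u ⊢∀ , Slash-to-depth (φ [ u / x ]) (depth-inst-< x u φ ≤-refl) (s u)

  Slashed-∃ : ∀ u → Slashed (φ [ u / x ]) → Slashed (Fex x φ)
  Slashed-∃ {φ} {x} u (⊢φu , sφu) =
    ∃-intro u ⊢φu , u , ⊢φu , Slash-from-depth (φ [ u / x ]) (depth-inst-< x u φ ≤-refl) sφu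

  Slashed-∃⁻ : Slashed (Fex x φ) → ∃[ u ] Slashed (φ [ u / x ])
  Slashed-∃⁻ {x} {φ} (_ , u , ⊢φu , sφu) =
    u , ⊢φu , Slash-to-depth (φ [ u / x ]) (depth-inst-< x u φ ≤-refl) sφu

  Slashedˢ : Subst → Formula → Set
  Slashedˢ σ φ = Slashed (sub σ φ)

  All-Slashedˢ-update : FreshL a Γ → All (Slashedˢ σ) Γ → All (Slashedˢ (σ [ a ↦ t ])) Γ
  All-Slashedˢ-update []          []       = []
  All-Slashedˢ-update {a} {σ = σ} {t} (a∉ψ ∷ a∉Γ) (s ∷ ss) =
    subst Slashed (sym (sub-update-fresh σ a t _ a∉ψ)) s ∷ All-Slashedˢ-update a∉Γ ss

  Any-Slashedˢ-update⁻ : FreshL a Δ → Any (Slashedˢ (σ [ a ↦ t ])) Δ → Any (Slashedˢ σ) Δ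
  Any-Slashedˢ-update⁻ {a} {σ = σ} {t} (a∉ψ ∷ _) (here s) =
    here (subst Slashed (sub-update-fresh σ a t _ a∉ψ) s)
  Any-Slashedˢ-update⁻ (_ ∷ a∉Δ) (there s) = there (Any-Slashedˢ-update⁻ a∉Δ s)

  -- Stated for all substitution instances, since ∀R and ∃L vary their eigenvariable.
  sound : Γ ⊢ᴹ Δ → ∀ σ → All (Slashedˢ σ) Γ → Any (Slashedˢ σ) Δ
  sound (ax _) σ (s ∷ []) = here s
  sound ax⊤    σ []       = here Slashed-⊤
  sound (∧L d) σ (s ∷ ss) = sound d σ (proj₁ (Slashed-∧⁻ s) ∷ proj₂ (Slashed-∧⁻ s) ∷ ss)
  sound (∧R d e) σ ss with sound d σ ss | sound e σ ss
  ... | here sφ  | here sψ  = here (Slashed-∧ sφ sψ)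
  ... | there sΔ | _        = there sΔ
  ... | here _   | there sΔ = there sΔ
  sound (∨L d e) σ (s ∷ ss) with Slashed-∨⁻ s
  ... | inj₁ sφ = sound d σ (sφ ∷ ss)
  ... | inj₂ sψ = sound e σ (sψ ∷ ss)
  sound (∨R {φ = φ} {ψ} d) σ ss with sound d σ ss | ⊢ᴹ-closed d
  ... | here sφ          | _ , _ ∷ cψ ∷ _ = here (Slashed-∨ˡ (closedIn-sub σ ψ cψ) sφ)
  ... | there (here sψ)  | _ , cφ ∷ _     = here (Slashed-∨ʳ (closedIn-sub σ φ cφ) sψ)
  ... | there (there sΔ) | _              = there sΔ
  sound (⇒L d e) σ (s ∷ ss) with sound e σ ss
  ... | here (⊢φ , _) = sound d σ (Slashed-⇒⁻ s ⊢φ ∷ ss)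
  ... | there sΔ      = sΔ
  sound (⇒Rp {φ = φ} cφ d) σ ss with sound d σ ss
  ... | here sψ  = here (Slashed-⇒ (closedIn-sub σ φ cφ) sψ)
  ... | there sΔ = there sΔ
  sound (∀R {x = x} {φ} a a∉Γ (a∉φ ∷ a∉Δ) d) σ ss
    with sound d (σ [ a ↦ fv (freshVar 0 (sub σ φ ∷ Γ₀)) ]) (All-Slashedˢ-update a∉Γ ss)
  ... | here sφe = here (Slashed-∀ _ (All.tail e-fresh) (All.head e-fresh)
                                 (subst Slashed (sub-update-inst σ a _ x φ a∉φ) sφe))
    where
    e-fresh : FreshL (freshVar 0 (sub σ φ ∷ Γ₀)) (sub σ φ ∷ Γ₀)
    e-fresh = freshVar-fresh 0 (sub σ φ ∷ Γ₀)
  ... | there sΔ = there (Any-Slashedˢ-update⁻ a∉Δ sΔ)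
  sound (∀L {x = x} {φ} u d) σ (s ∷ ss) =
    sound d σ (subst Slashed (sym (sub-inst σ x u φ)) (Slashed-∀⁻ (subTerm σ u) s) ∷ ss)
  sound (∃R {x = x} {φ} u d) σ ss with sound d σ ss
  ... | here sφu = here (Slashed-∃ (subTerm σ u) (subst Slashed (sub-inst σ x u φ) sφu))
  ... | there sΔ = there sΔ
  sound (∃L {x = x} {φ} a (a∉φ ∷ a∉Γ) a∉Δ d) σ (s ∷ ss) with Slashed-∃⁻ s
  ... | u , sφu = Any-Slashedˢ-update⁻ a∉Δ
                    (sound d (σ [ a ↦ u ]) (subst Slashed (sym (sub-update-inst σ a u x φ a∉φ)) sφu
                                            ∷ All-Slashedˢ-update a∉Γ ss))
  sound (weak {Γ = Γ} _ _ d) σ ss = Anyₚ.++⁺ˡ (sound d σ (++⁻ˡ Γ ss))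
  sound (cut {Γ = Γ} {Δ} _ d e) σ ss with sound d σ (++⁻ˡ Γ ss)
  ... | here sφ  = Anyₚ.++⁺ʳ Δ (sound e σ (sφ ∷ ++⁻ʳ Γ ss))
  ... | there sΔ = Anyₚ.++⁺ˡ sΔ
  sound (sets Γ≈Γ' Δ≈Δ' d) σ ss = Any-resp-⊆ (≈ˢ⇒⊆ Δ≈Δ') (sound d σ (All-resp-⊇ (≈ˢ⇒⊆ Γ≈Γ') ss))

  disjunction : All Harrop Γ₀ → Γ₀ ⊢ᴹ [ α ∨ᶠ β ] → (⊢ α) ⊎ (⊢ β)
  disjunction harrop d with sound d fv (All.tabulate hypothesis)
    where
    hypothesis : ψ ∈ Γ₀ → Slashedˢ fv ψ
    hypothesis ψ∈ =
      subst Slashed (sym (sub-fv _)) (Slashed-harrop (All.lookup harrop ψ∈) (assumption ψ∈))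
  ... | here s = Sum.map proj₁ proj₁ (Slashed-∨⁻ (subst Slashed (sub-fv _) s))

-- QGP and QGPM

cutᴵ : Γ ⊢ᴵ φ → [ φ ] ⊢ᴵ θ → Γ ⊢ᴵ θ
cutᴵ {Γ} {θ = θ} d e = subst (_⊢ᴵ θ) (++-identityʳ Γ) (cut (⊢ᴹ-closed-conclusion (⊢ᴵ⇒⊢ᴹ d)) d e)

cutᴹ : Γ ⊢ᴹ [ φ ] → [ φ ] ⊢ᴹ Δ → Γ ⊢ᴹ Δ
cutᴹ {Γ} {Δ = Δ} d e = subst (_⊢ᴹ Δ) (++-identityʳ Γ) (cut (⊢ᴹ-closed-conclusion d) d e)

∧-projˡ : Closed (φ ∧ᶠ ψ) → [ φ ∧ᶠ ψ ] ⊢ᴵ φ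
∧-projˡ (cφ , cψ) = ∧L (weak (cψ ∷ []) (ax cφ))

∧-projʳ : Closed (φ ∧ᶠ ψ) → [ φ ∧ᶠ ψ ] ⊢ᴵ ψ
∧-projʳ {φ} {ψ} (cφ , cψ) = ∧L (sets (≈ˢ-swap ψ φ []) (weak (cφ ∷ []) (ax cψ)))

∀-inst : ∀ u → Closed (Fall x φ) → [ Fall x φ ] ⊢ᴵ φ [ u / x ]
∀-inst {x} {φ} u c∀ = ∀L u (ax (closedIn-inst x u φ c∀))

⊢ᴵ-provability : All Closed Γ → Provability Γ
⊢ᴵ-provability {Γ} cΓ = record
  { ⊢_         = Γ ⊢ᴵ_
  ; assumption = λ φ∈ → sets (≈ˢ-∷-absorb φ∈) (weak cΓ (ax (All.lookup cΓ φ∈)))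
  ; ⊤-intro    = weak cΓ ax⊤
  ; ∧-intro    = ∧R
  ; ∧-elimˡ    = λ d → cutᴵ d (∧-projˡ (closed d))
  ; ∧-elimʳ    = λ d → cutᴵ d (∧-projʳ (closed d))
  ; ∨-introˡ   = ∨R₁
  ; ∨-introʳ   = ∨R₂
  ; ⇒-intro    = ⇒Rp
  ; ⇒-elim     = modus-ponens
  ; ∀-intro    = λ a a∉Γ a∉φ d → ∀R a (a∉φ ∷ a∉Γ) d
  ; ∀-elim     = λ u d → cutᴵ d (∀-inst u (closed d))
  ; ∃-intro    = ∃R
  }
  where
  closed : Γ ⊢ᴵ φ → Closed φ
  closed = ⊢ᴹ-closed-conclusion ∘ ⊢ᴵ⇒⊢ᴹ

  modus-ponens : Γ ⊢ᴵ φ ⇒ᶠ ψ → Γ ⊢ᴵ φ → Γ ⊢ᴵ ψ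
  modus-ponens d e with closed d
  ... | cφ⇒ψ@(_ , cψ) = sets (≈ˢ-++-idem Γ) (cut cφ⇒ψ d (⇒L (weak cΓ (ax cψ)) e))

⊢ᴹ-provability : All Closed Γ → Provability Γ
⊢ᴹ-provability {Γ} cΓ = record
  { ⊢_         = λ φ → Γ ⊢ᴹ [ φ ]
  ; assumption = λ φ∈ → sets (≈ˢ-∷-absorb φ∈) ≈ˢ-refl (weak cΓ [] (ax (All.lookup cΓ φ∈)))
  ; ⊤-intro    = weak cΓ [] ax⊤
  ; ∧-intro    = ∧R
  ; ∧-elimˡ    = λ d → cutᴹ d (⊢ᴵ⇒⊢ᴹ (∧-projˡ (⊢ᴹ-closed-conclusion d)))
  ; ∧-elimʳ    = λ d → cutᴹ d (⊢ᴵ⇒⊢ᴹ (∧-projʳ (⊢ᴹ-closed-conclusion d)))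
  ; ∨-introˡ   = ⊢ᴹ-∨ˡ
  ; ∨-introʳ   = ⊢ᴹ-∨ʳ
  ; ⇒-intro    = ⇒Rp
  ; ⇒-elim     = modus-ponens
  ; ∀-intro    = λ a a∉Γ a∉φ d → ∀R a a∉Γ (a∉φ ∷ []) d
  ; ∀-elim     = λ u d → cutᴹ d (⊢ᴵ⇒⊢ᴹ (∀-inst u (⊢ᴹ-closed-conclusion d)))
  ; ∃-intro    = ∃R
  }
  where
  modus-ponens : Γ ⊢ᴹ [ φ ⇒ᶠ ψ ] → Γ ⊢ᴹ [ φ ] → Γ ⊢ᴹ [ ψ ]
  modus-ponens d e with ⊢ᴹ-closed-conclusion d
  ... | cφ⇒ψ@(_ , cψ) =
    sets (≈ˢ-++-idem Γ) ≈ˢ-refl (cut cφ⇒ψ d (⇒L (weak cΓ [] (ax cψ)) (⊢ᴹ-weakenʳ cψ e)))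

QGP-disjunction : All Harrop Γ → Γ ⊢ᴵ α ∨ᶠ β → (Γ ⊢ᴵ α) ⊎ (Γ ⊢ᴵ β)
QGP-disjunction harrop d =
  AczelSlash.disjunction (⊢ᴵ-provability (proj₁ (⊢ᴹ-closed (⊢ᴵ⇒⊢ᴹ d)))) harrop (⊢ᴵ⇒⊢ᴹ d)

QGPM-disjunction : All Harrop Γ → Γ ⊢ᴹ [ α ∨ᶠ β ] → (Γ ⊢ᴹ [ α ]) ⊎ (Γ ⊢ᴹ [ β ])
QGPM-disjunction harrop d = AczelSlash.disjunction (⊢ᴹ-provability (proj₁ (⊢ᴹ-closed d))) harrop d

theorem9 :
    ((Γ : List Formula) (α β : Formula) → All Harrop Γ →
      Γ ⊢ᴵ α ∨ᶠ β → (Γ ⊢ᴵ α) ⊎ (Γ ⊢ᴵ β))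
    ×
    ((Γ : List Formula) (α β : Formula) → All Harrop Γ →
      Γ ⊢ᴹ [ α ∨ᶠ β ] → (Γ ⊢ᴹ [ α ]) ⊎ (Γ ⊢ᴹ [ β ]))
theorem9 = (λ _ _ _ → QGP-disjunction) , (λ _ _ _ → QGPM-disjunction)
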